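{- Let $L$ be a Boolean algebra with the change action $\hat L_{\bowtie}$, let $\hat A$ be an arbitrary change action, and let $f:A\to L$ be a function. Then the derivatives of $f$ are precisely the functions $\partial f:A\times\Delta A\to L\bowtie L$ such that $\partial f_{\ominus_\bot}\le_\Delta\partial f\le_\Delta\partial f_{\ominus_\top}$ pointwise, where $\partial f_{\ominus_\bot}(x,\delta)=(f(x\oplus_A\delta)\wedge\neg f(x),\ \neg f(x\oplus_A\delta))$ and $\partial f_{\ominus_\top}(x,\delta)=(f(x\oplus_A\delta),\ f(x)\wedge\neg f(x\oplus_A\delta))$.
   Context: $\hat L_{\bowtie}$ is the change action with base $L$, change set $L\bowtie L=\{(p,q)\in L\times L\mid p\wedge q=\bot\}$, monoid operation $(p,q)\bowtie(r,s)=((p\wedge\neg s)\vee r,(q\wedge\neg r)\vee s)$ with identity $(\bot,\bot)$, and action $a\oplus_{\bowtie}(p,q)=(a\vee p)\wedge\neg q$. A change action $\hat A=(A,\Delta A,\oplus_A,+,0)$ is a set $A$, a monoid $(\Delta A,+,0)$ and a monoid action $\oplus_A:A\times\Delta A\to A$ ($a\oplus 0=a$, $a\oplus(\delta_1+\delta_2)=(a\oplus\delta_1)\oplus\delta_2$). A derivative of $f:A\to L$ is $\partial f:A\times\Delta A\to L\bowtie L$ with $f(x\oplus_A\delta)=f(x)\oplus_{\bowtie}\partial f(x,\delta)$ for all $x,\delta$. For $\delta_1,\delta_2\in L\bowtie L$, $\delta_1\le_\Delta\delta_2$ means $b\oplus_{\bowtie}\delta_1\le b\oplus_{\bowtie}\delta_2$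 for all $b\in L$; this is extended pointwise to functions. -}

module Defs where

open import Level using (Level; _⊔_; suc)
open import Data.Product using (Σ; _×_; _,_; proj₁; proj₂)
open import Relation.Binary.PropositionalEquality using (_≡_)
open import Algebra.Lattice.Bundles using (BooleanAlgebra)
import Algebra.Lattice.Properties.BooleanAlgebra

record ChangeAction (a d : Level) : Set (suc (a ⊔ d)) where
  infixl 6 _⊕_
  infixl 7 _+Δ_
  field
    A       : Set a
    ΔA      : Set d
    _⊕_     : A → ΔA → A
    _+Δ_    : ΔA → ΔA → ΔA
    0Δ      : ΔA
    +-assoc : ∀ x y z → (x +Δ y) +Δ z ≡ x +Δ (y +Δ z)
    +-idˡ   : ∀ x → 0Δ +Δ x ≡ x
    +-idʳ   : ∀ x → x +Δ 0Δ ≡ x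
    ⊕-id    : ∀ x → x ⊕ 0Δ ≡ x
    ⊕-act   : ∀ x δ₁ δ₂ → x ⊕ (δ₁ +Δ δ₂) ≡ (x ⊕ δ₁) ⊕ δ₂

module BowtieChange {c ℓ : Level} (L : BooleanAlgebra c ℓ) where
  open BooleanAlgebra L
  private module BAP = Algebra.Lattice.Properties.BooleanAlgebra L

  _≤L_ : Carrier → Carrier → Set ℓ
  x ≤L y = (x ∧ y) ≈ x

  Δ⋈ : Set (c ⊔ ℓ)
  Δ⋈ = Σ (Carrier × Carrier) (λ pq → (proj₁ pq ∧ proj₂ pq) ≈ ⊥)

  _⊕⋈_ : Carrier → Δ⋈ → Carrier
  a ⊕⋈ ((p , q) , _) = (a ∨ p) ∧ (¬ q)

  _≤Δ_ : Δ⋈ → Δ⋈ → Set (c ⊔ ℓ)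
  δ₁ ≤Δ δ₂ = ∀ b → (b ⊕⋈ δ₁) ≤L (b ⊕⋈ δ₂)

  disj⊥ : ∀ y x → ((y ∧ ¬ x) ∧ ¬ y) ≈ ⊥
  disj⊥ y x = trans (∧-assoc _ _ _)
              (trans (∧-congˡ (∧-comm _ _))
              (trans (sym (∧-assoc _ _ _))
              (trans (∧-congʳ (∧-complementʳ _))
              (BAP.∧-zeroˡ _))))

  disj⊤ : ∀ y x → (y ∧ (x ∧ ¬ y)) ≈ ⊥
  disj⊤ y x = trans (∧-congˡ (∧-comm _ _))
              (trans (sym (∧-assoc _ _ _))
              (trans (∧-congʳ (∧-complementʳ _))
              (BAP.∧-zeroˡ _)))

  module _ {a d : Level} (Â : ChangeAction a d) where
    open ChangeAction Â

    IsDerivative : (A → Carrier) → (A → ΔA → Δ⋈) → Set (a ⊔ d ⊔ ℓ)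
    IsDerivative f ∂f = ∀ x δ → f (x ⊕ δ) ≈ (f x ⊕⋈ ∂f x δ)

    _≤Δ→_ : (A → ΔA → Δ⋈) → (A → ΔA → Δ⋈) → Set (a ⊔ d ⊔ c ⊔ ℓ)
    g ≤Δ→ h = ∀ x δ → g x δ ≤Δ h x δ

    ∂⊖⊥ : (A → Carrier) → A → ΔA → Δ⋈
    ∂⊖⊥ f x δ = ((f (x ⊕ δ) ∧ ¬ f x , ¬ f (x ⊕ δ)) , disj⊥ (f (x ⊕ δ)) (f x))

    ∂⊖⊤ : (A → Carrier) → A → ΔA → Δ⋈
    ∂⊖⊤ f x δ = ((f (x ⊕ δ) , f x ∧ ¬ f (x ⊕ δ)) , disj⊤ (f (x ⊕ δ)) (f x))

-- Let a = f x and b = f (x ⊕ δ). The action c ⊕⋈ (p , q) = (c ∨ p) ∧ ¬ q is monotone in p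
-- and antitone in q, so ≤Δ holds as soon as the added part grows and the removed part shrinks.
-- If a ⊕⋈ (p , q) = b, then b ∧ ¬ a ≤ p ≤ b and a ∧ ¬ b ≤ q ≤ ¬ b: the change must add at least
-- what b gained over a and at most b, and remove at least what a lost and at most ¬ b. These
-- extremes are exactly b ⊖⊥ a and b ⊖⊤ a. Conversely, both extremes carry a to b, so evaluating
-- the two inequalities at a itself squeezes a ⊕⋈ δ between b and b.
module Submission where

open import Defs
open import Level using (Level)
open import Function.Bundles using (_⇔_; mk⇔; module Equivalence)
open import Algebra.Lattice.Bundles using (BooleanAlgebra)
open import Data.Product using (_×_; _,_; proj₁; proj₂)
import Algebra.Lattice.Properties.BooleanAlgebra as BooleanAlgebraProperties
import Algebra.Lattice.Properties.Lattice as LatticeProperties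
import Relation.Binary.Lattice as OrderTheoretic
import Relation.Binary.Lattice.Properties.JoinSemilattice as JoinSemilatticeProperties
import Relation.Binary.Lattice.Properties.MeetSemilattice as MeetSemilatticeProperties
import Relation.Binary.Reasoning.PartialOrder as PartialOrderReasoning

module BooleanAlgebraOrder {c ℓ : Level} (L : BooleanAlgebra c ℓ) where
  open BooleanAlgebra L
  open BooleanAlgebraProperties L using (¬-involutive; ∧-identityʳ; ∨-identityʳ; ∨-identityˡ; ∧-zeroˡ)
  open BowtieChange L using (_≤L_)

  orderTheoreticLattice : OrderTheoretic.Lattice c ℓ ℓ
  orderTheoreticLattice = LatticeProperties.∨-∧-orderTheoreticLattice lattice

  open OrderTheoretic.Lattice orderTheoreticLattice public
    using (_≤_; poset; antisym; x≤x∨y; y≤x∨y; x∧y≤x; x∧y≤y; ∧-greatest)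
    renaming (refl to ≤-refl; trans to ≤-trans; reflexive to ≤-reflexive)
  open OrderTheoretic.Lattice orderTheoreticLattice using (joinSemilattice; meetSemilattice)
  open JoinSemilatticeProperties joinSemilattice public using (∨-monotonic)
  open MeetSemilatticeProperties meetSemilattice public using (∧-monotonic)
  open PartialOrderReasoning poset

  ≤⇒≤L : ∀ {x y} → x ≤ y → x ≤L y
  ≤⇒≤L = sym

  ≤L⇒≤ : ∀ {x y} → x ≤L y → x ≤ y
  ≤L⇒≤ = sym

  ⊥-minimum : ∀ x → ⊥ ≤ x
  ⊥-minimum x = sym (∧-zeroˡ x)

  x≤y∨z⇒x∧¬y≤z : ∀ {x y z} → x ≤ y ∨ z → x ∧ ¬ y ≤ z
  x≤y∨z⇒x∧¬y≤z {x} {y} {z} x≤y∨z = begin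
    x ∧ ¬ y                    ≤⟨ ∧-monotonic x≤y∨z ≤-refl ⟩
    (y ∨ z) ∧ ¬ y              ≈⟨ ∧-distribʳ-∨ (¬ y) y z ⟩
    (y ∧ ¬ y) ∨ (z ∧ ¬ y)      ≈⟨ ∨-congʳ (∧-complementʳ y) ⟩
    ⊥ ∨ (z ∧ ¬ y)              ≈⟨ ∨-identityˡ (z ∧ ¬ y) ⟩
    z ∧ ¬ y                    ≤⟨ x∧y≤x z (¬ y) ⟩
    z                          ∎

  x∧y≤z⇒x≤¬y∨z : ∀ {x y z} → x ∧ y ≤ z → x ≤ ¬ y ∨ z
  x∧y≤z⇒x≤¬y∨z {x} {y} {z} x∧y≤z = begin
    x                          ≈⟨ ∧-identityʳ x ⟨
    x ∧ ⊤                      ≈⟨ ∧-congˡ (∨-complementʳ y) ⟨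
    x ∧ (y ∨ ¬ y)              ≈⟨ ∧-distribˡ-∨ x y (¬ y) ⟩
    (x ∧ y) ∨ (x ∧ ¬ y)        ≤⟨ ∨-monotonic x∧y≤z (x∧y≤y x (¬ y)) ⟩
    z ∨ ¬ y                    ≈⟨ ∨-comm z (¬ y) ⟩
    ¬ y ∨ z                    ∎

  x∧y≈⊥⇒x≤¬y : ∀ {x y} → x ∧ y ≈ ⊥ → x ≤ ¬ y
  x∧y≈⊥⇒x≤¬y {x} {y} x∧y≈⊥ = begin
    x       ≤⟨ x∧y≤z⇒x≤¬y∨z (≤-reflexive x∧y≈⊥) ⟩
    ¬ y ∨ ⊥ ≈⟨ ∨-identityʳ (¬ y) ⟩
    ¬ y     ∎

  x≤¬y⇒x∧y≈⊥ : ∀ {x y} → x ≤ ¬ y → x ∧ y ≈ ⊥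
  x≤¬y⇒x∧y≈⊥ {x} {y} x≤¬y = antisym x∧y≤⊥ (⊥-minimum (x ∧ y))
    where
    x∧y≤⊥ : x ∧ y ≤ ⊥
    x∧y≤⊥ = begin
      x ∧ y   ≤⟨ ∧-monotonic x≤¬y ≤-refl ⟩
      ¬ y ∧ y ≈⟨ ∧-complementˡ y ⟩
      ⊥       ∎

  x≤¬y⇒y≤¬x : ∀ {x y} → x ≤ ¬ y → y ≤ ¬ x
  x≤¬y⇒y≤¬x {x} {y} x≤¬y = x∧y≈⊥⇒x≤¬y (trans (∧-comm y x) (x≤¬y⇒x∧y≈⊥ x≤¬y))

  ¬-antitone : ∀ {x y} → x ≤ y → ¬ y ≤ ¬ x
  ¬-antitone {x} {y} x≤y = x≤¬y⇒y≤¬x (≤-trans x≤y (≤-reflexive (sym (¬-involutive y))))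

module BowtieOrder {c ℓ : Level} (L : BooleanAlgebra c ℓ) where
  open BooleanAlgebra L
  open BooleanAlgebraProperties L using (¬-involutive; ∧-identityʳ; ∨-identityˡ; deMorgan₁)
  open BowtieChange L
  open BooleanAlgebraOrder L
  open PartialOrderReasoning poset

  added removed : Δ⋈ → Carrier
  added δ = proj₁ (proj₁ δ)
  removed δ = proj₂ (proj₁ δ)

  -- ∂⊖⊥ f x δ and ∂⊖⊤ f x δ unfold to f (x ⊕ δ) ⊖⊥ f x and f (x ⊕ δ) ⊖⊤ f x.
  _⊖⊥_ _⊖⊤_ : Carrier → Carrier → Δ⋈
  b ⊖⊥ a = ((b ∧ ¬ a , ¬ b) , disj⊥ b a)
  b ⊖⊤ a = ((b , a ∧ ¬ b) , disj⊤ b a)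

  ≤Δ-intro : ∀ {δ δ′} → added δ ≤ added δ′ → removed δ′ ≤ removed δ → δ ≤Δ δ′
  ≤Δ-intro added≤ removed≤ c = ≤⇒≤L (∧-monotonic (∨-monotonic ≤-refl added≤) (¬-antitone removed≤))

  ⊕⋈-⊖⊥ : ∀ a b → a ⊕⋈ (b ⊖⊥ a) ≈ b
  ⊕⋈-⊖⊥ a b = begin-equality
    (a ∨ (b ∧ ¬ a)) ∧ ¬ ¬ b     ≈⟨ ∧-cong (∨-distribˡ-∧ a b (¬ a)) (¬-involutive b) ⟩
    ((a ∨ b) ∧ (a ∨ ¬ a)) ∧ b   ≈⟨ ∧-congʳ (∧-congˡ (∨-complementʳ a)) ⟩
    ((a ∨ b) ∧ ⊤) ∧ b           ≈⟨ ∧-congʳ (∧-identityʳ (a ∨ b)) ⟩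
    (a ∨ b) ∧ b                 ≈⟨ ∧-comm (a ∨ b) b ⟩
    b ∧ (a ∨ b)                 ≈⟨ ∧-congˡ (∨-comm a b) ⟩
    b ∧ (b ∨ a)                 ≈⟨ ∧-absorbs-∨ b a ⟩
    b                           ∎

  ⊕⋈-⊖⊤ : ∀ a b → a ⊕⋈ (b ⊖⊤ a) ≈ b
  ⊕⋈-⊖⊤ a b = begin-equality
    (a ∨ b) ∧ ¬ (a ∧ ¬ b)       ≈⟨ ∧-congˡ (trans (deMorgan₁ a (¬ b)) (∨-congˡ (¬-involutive b))) ⟩
    (a ∨ b) ∧ (¬ a ∨ b)         ≈⟨ ∨-distribʳ-∧ b a (¬ a) ⟨
    (a ∧ ¬ a) ∨ b               ≈⟨ ∨-congʳ (∧-complementʳ a) ⟩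
    ⊥ ∨ b                       ≈⟨ ∨-identityˡ b ⟩
    b                           ∎

  ⊖⊥-least : ∀ {a b} δ → b ≈ a ⊕⋈ δ → (b ⊖⊥ a) ≤Δ δ
  ⊖⊥-least {a} {b} δ@((p , q) , _) b≈a⊕δ = ≤Δ-intro {b ⊖⊥ a} {δ} gained≤p q≤¬b
    where
    b≤a∨p : b ≤ a ∨ p
    b≤a∨p = ≤-trans (≤-reflexive b≈a⊕δ) (x∧y≤x (a ∨ p) (¬ q))

    gained≤p : b ∧ ¬ a ≤ p
    gained≤p = x≤y∨z⇒x∧¬y≤z b≤a∨p

    q≤¬b : q ≤ ¬ b
    q≤¬b = x≤¬y⇒y≤¬x (≤-trans (≤-reflexive b≈a⊕δ) (x∧y≤y (a ∨ p) (¬ q)))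

  ⊖⊤-greatest : ∀ {a b} δ → b ≈ a ⊕⋈ δ → δ ≤Δ (b ⊖⊤ a)
  ⊖⊤-greatest {a} {b} δ@((p , q) , p∧q≈⊥) b≈a⊕δ = ≤Δ-intro {δ} {b ⊖⊤ a} p≤b lost≤q
    where
    p≤b : p ≤ b
    p≤b = ≤-trans (∧-greatest (y≤x∨y a p) (x∧y≈⊥⇒x≤¬y p∧q≈⊥)) (≤-reflexive (sym b≈a⊕δ))

    a∧¬q≤b : a ∧ ¬ q ≤ b
    a∧¬q≤b = ≤-trans (∧-monotonic (x≤x∨y a p) ≤-refl) (≤-reflexive (sym b≈a⊕δ))

    a≤b∨q : a ≤ b ∨ q
    a≤b∨q = begin
      a             ≤⟨ x∧y≤z⇒x≤¬y∨z a∧¬q≤b ⟩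
      ¬ ¬ q ∨ b     ≈⟨ ∨-congʳ (¬-involutive q) ⟩
      q ∨ b         ≈⟨ ∨-comm q b ⟩
      b ∨ q         ∎

    lost≤q : a ∧ ¬ b ≤ q
    lost≤q = x≤y∨z⇒x∧¬y≤z a≤b∨q

  squeezed : ∀ {a b} δ → (b ⊖⊥ a) ≤Δ δ → δ ≤Δ (b ⊖⊤ a) → b ≈ a ⊕⋈ δ
  squeezed {a} {b} δ ⊖⊥≤δ δ≤⊖⊤ = antisym
    (begin
      b             ≈⟨ ⊕⋈-⊖⊥ a b ⟨
      a ⊕⋈ (b ⊖⊥ a) ≤⟨ ≤L⇒≤ (⊖⊥≤δ a) ⟩
      a ⊕⋈ δ        ∎)
    (begin
      a ⊕⋈ δ        ≤⟨ ≤L⇒≤ (δ≤⊖⊤ a) ⟩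
      a ⊕⋈ (b ⊖⊤ a) ≈⟨ ⊕⋈-⊖⊤ a b ⟩
      b             ∎)

  ⊕⋈≈⇔between-⊖ : ∀ a b δ → (b ≈ a ⊕⋈ δ) ⇔ ((b ⊖⊥ a) ≤Δ δ × δ ≤Δ (b ⊖⊤ a))
  ⊕⋈≈⇔between-⊖ a b δ = mk⇔
    (λ b≈a⊕δ → ⊖⊥-least δ b≈a⊕δ , ⊖⊤-greatest δ b≈a⊕δ)
    (λ (⊖⊥≤δ , δ≤⊖⊤) → squeezed δ ⊖⊥≤δ δ≤⊖⊤)

mainTheorem10 : ∀ {c ℓ a d : Level} (L : BooleanAlgebra c ℓ) (Â : ChangeAction a d)
                  (f : ChangeAction.A Â → BooleanAlgebra.Carrier L)
                  (∂f : ChangeAction.A Â → ChangeAction.ΔA Â → BowtieChange.Δ⋈ L) →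
                  BowtieChange.IsDerivative L Â f ∂f
                    ⇔ (BowtieChange._≤Δ→_ L Â (BowtieChange.∂⊖⊥ L Â f) ∂f
                        × BowtieChange._≤Δ→_ L Â ∂f (BowtieChange.∂⊖⊤ L Â f))
mainTheorem10 L Â f ∂f = mk⇔
  (λ isDerivative → (λ x δ → proj₁ (to (characterisation x δ) (isDerivative x δ)))
                  , (λ x δ → proj₂ (to (characterisation x δ) (isDerivative x δ))))
  (λ (lower , upper) x δ → from (characterisation x δ) (lower x δ , upper x δ))
  where
  open BooleanAlgebra L using (_≈_)
  open ChangeAction Â
  open BowtieChange L using (_⊕⋈_; _≤Δ_)
  open BowtieOrder L
  open Equivalence using (to; from)

  characterisation : ∀ x δ → (f (x ⊕ δ) ≈ f x ⊕⋈ ∂f x δ)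
                             ⇔ ((f (x ⊕ δ) ⊖⊥ f x) ≤Δ ∂f x δ × ∂f x δ ≤Δ (f (x ⊕ δ) ⊖⊤ f x))
  characterisation x δ = ⊕⋈≈⇔between-⊖ (f x) (f (x ⊕ δ)) (∂f x δ)
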